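{- Let $p$ be an odd prime and $i\in\{1,2,3\}$. The number of points $(x,y,z)\in\mathbb{X}^*_{ -2}(\mathbb{F}_p)$ with $m_i(x,y,z)=(x,y,z)$ equals $p-5$ if $p\equiv1\pmod 4$ and $p-3$ if $p\equiv 3\pmod 4$.
   Context: $\mathbb{X}^*_{ -2}(\mathbb{F}_p)=\{(x,y,z)\in\mathbb{F}_p^3 : x^2+y^2+z^2=xyz\}\setminus\{(0,0,0)\}$. The Markoff moves are $m_1(x,y,z)=(yz-x,y,z)$, $m_2(x,y,z)=(x,xz-y,z)$, $m_3(x,y,z)=(x,y,xy-z)$. -}

module Defs where

open import Data.Nat using (ℕ; zero; suc; _∸_; NonZero)
import Data.Nat as ℕ
open import Data.Nat.DivMod using (_mod_)
open import Data.Fin using (Fin; toℕ)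
import Data.Fin.Properties as FinP
open import Data.Product using (_×_; _,_)
open import Data.Product.Properties using (≡-dec)
open import Data.List using (List; length; filter; allFin; cartesianProduct)
open import Relation.Binary.PropositionalEquality using (_≡_)
open import Relation.Nullary using (Dec; ¬_; _×-dec_; ¬?)
open import Relation.Binary.Definitions using (DecidableEquality)

module Field (p : ℕ) .{{_ : NonZero p}} where

  F : Set
  F = Fin p

  infixl 6 _+F_ _-F_
  infixl 7 _*F_

  _+F_ : F → F → F
  a +F b = (toℕ a ℕ.+ toℕ b) mod p

  _*F_ : F → F → F
  a *F b = (toℕ a ℕ.* toℕ b) mod p

  -F_ : F → F
  -F a = (p ∸ toℕ a) mod p

  _-F_ : F → F → F
  a -F b = a +F (-F b)

  0F : F
  0F = 0 mod p

  Triple : Set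
  Triple = F × F × F

  _≟T_ : DecidableEquality Triple
  _≟T_ = ≡-dec FinP._≟_ (≡-dec FinP._≟_ FinP._≟_)

  InX* : Triple → Set
  InX* (x , y , z) = ((x *F x +F y *F y +F z *F z) ≡ (x *F y *F z))
                     × ¬ ((x , y , z) ≡ (0F , 0F , 0F))

  InX*? : (t : Triple) → Dec (InX* t)
  InX*? (x , y , z) = ((x *F x +F y *F y +F z *F z) FinP.≟ (x *F y *F z))
                      ×-dec ¬? ((x , y , z) ≟T (0F , 0F , 0F))

  -- Markoff moves m_1, m_2, m_3 (indexed by Fin 3: 0 ↦ m_1, 1 ↦ m_2, 2 ↦ m_3)
  move : Fin 3 → Triple → Triple
  move Fin.zero (x , y , z) = (y *F z -F x , y , z)
  move (Fin.suc Fin.zero) (x , y , z) = (x , x *F z -F y , z)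
  move (Fin.suc (Fin.suc Fin.zero)) (x , y , z) = (x , y , x *F y -F z)

  allTriples : List Triple
  allTriples = cartesianProduct (allFin p) (cartesianProduct (allFin p) (allFin p))

  FixedPt : Fin 3 → Triple → Set
  FixedPt i t = InX* t × (move i t ≡ t)

  FixedPt? : (i : Fin 3) → (t : Triple) → Dec (FixedPt i t)
  FixedPt? i t = InX*? t ×-dec (move i t ≟T t)

  numFixed : Fin 3 → ℕ
  numFixed i = length (filter (FixedPt? i) allTriples)

-- A point of X*₋₂ fixed by m₁ has yz = 2x, so its (y, z) lies on the curve 4y² + 4z² = y²z².
-- This curve is rational: t = z(y − 2)/(2y) identifies the fixed points of m₁ with the
-- parameters t ∉ {0} ∪ {t⁴ = 1}, with inverse y = 2(1 + t²)/(1 − t²), z = (1 + t²)/t,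
-- x = yz/2. The moves m₂ and m₃ are conjugate to m₁ by permuting coordinates. Hence every
-- count is p − 1 − #{t⁴ = 1}, that is p − 3 or p − 5 according as −1 is a square mod p.
-- Which case occurs is decided without Euler's criterion: the admissible parameters split
-- into the orbits {t, −t, t⁻¹, −t⁻¹} of size four, so the count is divisible by 4, and only one
-- of p − 3, p − 5 is.

module Submission where

open import Defs
open import Algebra.Bundles using (CommutativeRing)
open import Algebra.Consequences.Propositional using (comm∧idˡ⇒id; comm∧invˡ⇒inv; comm∧distrˡ⇒distr)
open import Algebra.Core using (Op₁; Op₂)
open import Algebra.Solver.Ring.AlmostCommutativeRing using (fromCommutativeRing; _-Raw-AlmostCommutative⟶_)
open import Algebra.Structures using (IsCommutativeRing)
open import Data.Empty using (⊥-elim)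
open import Data.Fin using (Fin; toℕ)
import Data.Fin.Properties as Fin
open import Data.Integer as ℤ using (ℤ; -[1+_]; _⊖_)
import Data.Integer.Properties as ℤ
open import Data.List using (List; []; _∷_; length; filter; map; allFin)
open import Data.List.Properties using (length-map; map-∘; map-id-local; filter-notAll; length-tabulate)
open import Data.List.Membership.Propositional using (_∈_)
open import Data.List.Membership.Propositional.Properties
  using (∈-filter⁺; ∈-filter⁻; ∈-map⁺; ∈-map⁻; ∈-allFin; ∈-cartesianProduct⁺)
open import Data.List.Membership.Propositional.Properties.WithK using (unique∧set⇒bag)
open import Data.List.Relation.Binary.BagAndSetEquality using (_∼[_]_; set; ∼bag⇒↭)
open import Data.List.Relation.Binary.Permutation.Propositional.Properties using (↭-length)
open import Data.List.Relation.Unary.All as All using (All; []; _∷_)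
open import Data.List.Relation.Unary.All.Properties using (all-filter; filter⁺)
open import Data.List.Relation.Unary.AllPairs using ([]; _∷_)
open import Data.List.Relation.Unary.Any using (here; there)
open import Data.List.Relation.Unary.Unique.Propositional using (Unique)
import Data.List.Relation.Unary.Unique.Propositional.Properties as Unique
import Data.Maybe as Maybe
open import Data.Nat as ℕ using (ℕ; suc; NonZero; _%_; _∸_)
open import Data.Nat.Coprimality using (prime⇒coprime; coprime-Bézout)
open import Data.Nat.DivMod using (_mod_; %-distribˡ-+; %-distribˡ-*; %-remove-+ˡ; m<n⇒m%n≡m; m%n<n; m*n%n≡0; n%n≡0)
open import Data.Nat.Divisibility using (_∣_; _∣0; ∣m∣n⇒∣m+n; ∣-reflexive)
open import Data.Nat.GCD using (module Bézout)
open import Data.Nat.Induction using (<-wellFounded)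
open import Data.Nat.Primality using (Prime; prime⇒nonTrivial)
import Data.Nat.Properties as ℕ
open import Data.Product as Product using (_×_; _,_; proj₁; proj₂; ∃)
open import Data.Sign as Sign using (Sign)
open import Data.Sum as Sum using (_⊎_; inj₁; inj₂; [_,_]′)
open import Function using (id; _∘_; _⇔_; mk⇔)
open import Function.Construct.Composition using (_⇔-∘_)
open import Induction.WellFounded using (Acc; acc)
open import Level using (0ℓ)
open import Relation.Binary.Consequences using (dec⇒weaklyDec)
open import Relation.Binary.Definitions using (DecidableEquality)
open import Relation.Binary.PropositionalEquality
  using (_≡_; _≢_; refl; sym; trans; cong; cong₂; subst; subst₂; isEquivalence; module ≡-Reasoning)
open import Relation.Nullary using (¬_; yes; no; contradiction; ¬?; _×-dec_)
open import Relation.Unary using (Pred; Decidable)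
open import Relation.Unary.Properties using (∁?)

module _ {A : Set} where

  length-filter-∁ : {P : Pred A 0ℓ} (P? : Decidable P) (xs : List A) →
                    length (filter P? xs) ℕ.+ length (filter (∁? P?) xs) ≡ length xs
  length-filter-∁ P? []       = refl
  length-filter-∁ P? (x ∷ xs) with P? x
  ... | yes _ = cong suc (length-filter-∁ P? xs)
  ... | no  _ = trans (ℕ.+-suc _ _) (cong suc (length-filter-∁ P? xs))

  unique∧set⇒length-≡ : {xs ys : List A} → Unique xs → Unique ys → xs ∼[ set ] ys →
                         length xs ≡ length ys
  unique∧set⇒length-≡ xs! ys! xs∼ys = ↭-length (∼bag⇒↭ (unique∧set⇒bag xs! ys! xs∼ys))

module _ {A B : Set} {P : Pred A 0ℓ} {Q : Pred B 0ℓ} (P? : Decidable P) (Q? : Decidable Q)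
         (f : A → B) (g : B → A)
         (f-Q : ∀ {a} → P a → Q (f a)) (g-P : ∀ {b} → Q b → P (g b))
         (g∘f : ∀ {a} → P a → g (f a) ≡ a) (f∘g : ∀ {b} → Q b → f (g b) ≡ b) where

  length-filter-bijection : {xs : List A} {ys : List B} → Unique xs → Unique ys →
                            (∀ a → a ∈ xs) → (∀ b → b ∈ ys) →
                            length (filter P? xs) ≡ length (filter Q? ys)
  length-filter-bijection {xs} {ys} xs! ys! ∈xs ∈ys = begin
    length Ps              ≡⟨ length-map f Ps ⟨
    length (map f Ps)      ≡⟨ unique∧set⇒length-≡ fPs! (Unique.filter⁺ Q? ys!) (mk⇔ to from) ⟩
    length (filter Q? ys)  ∎
    where
    open ≡-Reasoning
    Ps = filter P? xs
    g∘f≡id : map g (map f Ps) ≡ Ps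
    g∘f≡id = trans (sym (map-∘ Ps)) (map-id-local (All.map g∘f (all-filter P? xs)))
    fPs! : Unique (map f Ps)
    fPs! = Unique.map⁻ (subst Unique (sym g∘f≡id) (Unique.filter⁺ P? xs!))
    to : ∀ {b} → b ∈ map f Ps → b ∈ filter Q? ys
    to b∈ with a , a∈ , refl ← ∈-map⁻ f b∈ = ∈-filter⁺ Q? (∈ys _) (f-Q (proj₂ (∈-filter⁻ P? {xs = xs} a∈)))
    from : ∀ {b} → b ∈ filter Q? ys → b ∈ map f Ps
    from {b} b∈ = subst (_∈ map f Ps) (f∘g Qb) (∈-map⁺ f (∈-filter⁺ P? (∈xs (g b)) (g-P Qb)))
      where Qb = proj₂ (∈-filter⁻ Q? {xs = ys} b∈)

module Orbits {A : Set} (_≟_ : DecidableEquality A) {Q : Pred A 0ℓ} (k : ℕ) (orbit : A → List A)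
  (orbit-unique : ∀ {a} → Q a → Unique (orbit a))
  (orbit-length : ∀ {a} → Q a → length (orbit a) ≡ k)
  (∈-orbit : ∀ {a} → Q a → a ∈ orbit a)
  (orbit-sym : ∀ {a b} → Q b → a ∈ orbit b → b ∈ orbit a)
  (orbit-trans : ∀ {a b c} → Q a → b ∈ orbit a → c ∈ orbit b → c ∈ orbit a) where

  open import Data.List.Membership.DecPropositional _≟_ using (_∈?_)

  Closed : List A → Set
  Closed L = ∀ {a b} → a ∈ L → b ∈ orbit a → b ∈ L

  private
    orbits-divide-acc : ∀ {L} → Acc ℕ._<_ (length L) → Unique L → All Q L → Closed L → k ∣ length L
    orbits-divide-acc {[]}          _         _  _  _      = k ∣0
    orbits-divide-acc {L@(x ∷ _)} (acc rec) L! QL closed =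
      subst (k ∣_) (length-filter-∁ inside? L)
        (∣m∣n⇒∣m+n (∣-reflexive (sym |inside|))
          (orbits-divide-acc (rec |outside|<) (Unique.filter⁺ outside? L!) (filter⁺ outside? QL) outside-closed))
      where
      Qx = All.head QL
      inside? = _∈? orbit x
      outside? = ∁? inside?
      |inside| : length (filter inside? L) ≡ k
      |inside| = trans (unique∧set⇒length-≡ (Unique.filter⁺ inside? L!) (orbit-unique Qx)
                          (mk⇔ (proj₂ ∘ ∈-filter⁻ inside? {xs = L})
                               (λ b∈ → ∈-filter⁺ inside? (closed (here refl) b∈) b∈)))
                       (orbit-length Qx)
      |outside|< : length (filter outside? L) ℕ.< length L
      |outside|< = filter-notAll outside? L (here (λ x∉ → x∉ (∈-orbit Qx)))
      outside-closed : Closed (filter outside? L)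
      outside-closed a∈ b∈ with a∈L , a∉ ← ∈-filter⁻ outside? {xs = L} a∈ =
        ∈-filter⁺ outside? (closed a∈L b∈) (λ b∈x → a∉ (orbit-trans Qx b∈x (orbit-sym (All.lookup QL a∈L) b∈)))

  orbits-divide : ∀ {L} → Unique L → All Q L → Closed L → k ∣ length L
  orbits-divide = orbits-divide-acc (<-wellFounded _)

-- The ring solver normalises numerals such as 2 and 4 as integer coefficients, interpreted in
-- the ring through the canonical map ℤ → R.
module IntegerCoefficients
  {F : Set} {add mul : Op₂ F} {neg : Op₁ F} {zero one : F}
  (isCommutativeRing : IsCommutativeRing _≡_ add mul neg zero one) where

  commutativeRing : CommutativeRing 0ℓ 0ℓ
  commutativeRing = record { isCommutativeRing = isCommutativeRing }

  open CommutativeRing commutativeRing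
    using (_+_; _*_; -_; _-_; 0#; 1#; ring; semiring; *-commutativeSemigroup;
           +-assoc; +-comm; +-identityˡ; +-identityʳ; -‿inverseʳ; *-identityˡ; *-identityʳ)
  open import Algebra.Properties.Ring ring using (-‿involutive; -0#≈0#; -‿anti-homo-+; -1*x≈-x)
  open import Algebra.Properties.Semiring.Mult.TCOptimised semiring
    using (1+×; ×-homo-+; ×1-homo-*) renaming (_×_ to _×′_)
  open import Algebra.Properties.CommutativeSemigroup *-commutativeSemigroup using (interchange)

  -- in the optimised multiplication 1 ×′ x is x itself, so fromℤ (ℤ.+ 1) is 1# and fromℤ (ℤ.+ 2) is 1# + 1#
  -- definitionally
  fromℤ : ℤ → F
  fromℤ (ℤ.+ n)  = n ×′ 1#
  fromℤ -[1+ n ] = - (suc n ×′ 1#)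

  private
    sign : Sign → F
    sign Sign.+ = 1#
    sign Sign.- = - 1#

    sign-* : ∀ s t → sign (s Sign.* t) ≡ sign s * sign t
    sign-* Sign.- Sign.- = sym (trans (-1*x≈-x _) (-‿involutive _))
    sign-* Sign.- Sign.+ = sym (*-identityʳ _)
    sign-* Sign.+ _      = sym (*-identityˡ _)

    fromℤ-◃ : ∀ s n → fromℤ (s ℤ.◃ n) ≡ sign s * (n ×′ 1#)
    fromℤ-◃ Sign.- 0       = sym (trans (-1*x≈-x 0#) -0#≈0#)
    fromℤ-◃ Sign.- (suc n) = sym (-1*x≈-x _)
    fromℤ-◃ Sign.+ 0       = sym (*-identityˡ _)
    fromℤ-◃ Sign.+ (suc n) = sym (*-identityˡ _)

    fromℤ-sign-abs : ∀ i → fromℤ i ≡ sign (ℤ.sign i) * (ℤ.∣ i ∣ ×′ 1#)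
    fromℤ-sign-abs i = trans (cong fromℤ (sym (ℤ.◃-inverse i))) (fromℤ-◃ (ℤ.sign i) ℤ.∣ i ∣)

    [a+x]-[a+y]≡x-y : ∀ a x y → (a + x) - (a + y) ≡ x - y
    [a+x]-[a+y]≡x-y a x y = begin
      (a + x) + - (a + y)    ≡⟨ cong ((a + x) +_) (-‿anti-homo-+ a y) ⟩
      (a + x) + (- y + - a)  ≡⟨ cong₂ _+_ (+-comm a x) (+-comm (- y) (- a)) ⟩
      (x + a) + (- a + - y)  ≡⟨ +-assoc x a _ ⟩
      x + (a + (- a + - y))  ≡⟨ cong (x +_) (+-assoc a (- a) (- y)) ⟨
      x + ((a - a) + - y)    ≡⟨ cong (λ u → x + (u + - y)) (-‿inverseʳ a) ⟩
      x + (0# + - y)         ≡⟨ cong (x +_) (+-identityˡ (- y)) ⟩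
      x - y                  ∎
      where open ≡-Reasoning

    fromℤ-⊖ : ∀ m n → fromℤ (m ⊖ n) ≡ m ×′ 1# - n ×′ 1#
    fromℤ-⊖ 0       0       = sym (-‿inverseʳ 0#)
    fromℤ-⊖ 0       (suc n) = sym (+-identityˡ _)
    fromℤ-⊖ (suc m) 0       = sym (trans (cong (suc m ×′ 1# +_) -0#≈0#) (+-identityʳ _))
    fromℤ-⊖ (suc m) (suc n) = begin
      fromℤ (suc m ⊖ suc n)            ≡⟨ cong fromℤ (ℤ.[1+m]⊖[1+n]≡m⊖n m n) ⟩
      fromℤ (m ⊖ n)                    ≡⟨ fromℤ-⊖ m n ⟩
      m ×′ 1# - n ×′ 1#                ≡⟨ [a+x]-[a+y]≡x-y 1# (m ×′ 1#) (n ×′ 1#) ⟨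
      (1# + m ×′ 1#) - (1# + n ×′ 1#)  ≡⟨ cong₂ _-_ (1+× m 1#) (1+× n 1#) ⟨
      suc m ×′ 1# - suc n ×′ 1#        ∎
      where open ≡-Reasoning

  fromℤ-+ : ∀ i j → fromℤ (i ℤ.+ j) ≡ fromℤ i + fromℤ j
  fromℤ-+ -[1+ m ] -[1+ n ] = begin
    - (suc (suc (m ℕ.+ n)) ×′ 1#)      ≡⟨ cong (λ k → - (suc k ×′ 1#)) (ℕ.+-suc m n) ⟨
    - ((suc m ℕ.+ suc n) ×′ 1#)        ≡⟨ cong -_ (×-homo-+ 1# (suc m) (suc n)) ⟩
    - (suc m ×′ 1# + suc n ×′ 1#)      ≡⟨ -‿anti-homo-+ _ _ ⟩
    - (suc n ×′ 1#) + - (suc m ×′ 1#)  ≡⟨ +-comm _ _ ⟩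
    - (suc m ×′ 1#) + - (suc n ×′ 1#)  ∎
    where open ≡-Reasoning
  fromℤ-+ -[1+ m ] (ℤ.+ n)  = trans (fromℤ-⊖ n (suc m)) (+-comm _ _)
  fromℤ-+ (ℤ.+ m)  -[1+ n ] = fromℤ-⊖ m (suc n)
  fromℤ-+ (ℤ.+ m)  (ℤ.+ n)  = ×-homo-+ 1# m n

  fromℤ-* : ∀ i j → fromℤ (i ℤ.* j) ≡ fromℤ i * fromℤ j
  fromℤ-* i j = begin
    fromℤ (i ℤ.* j)
      ≡⟨ fromℤ-◃ (ℤ.sign i Sign.* ℤ.sign j) (ℤ.∣ i ∣ ℕ.* ℤ.∣ j ∣) ⟩
    sign (ℤ.sign i Sign.* ℤ.sign j) * ((ℤ.∣ i ∣ ℕ.* ℤ.∣ j ∣) ×′ 1#)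
      ≡⟨ cong₂ _*_ (sign-* (ℤ.sign i) (ℤ.sign j)) (×1-homo-* ℤ.∣ i ∣ ℤ.∣ j ∣) ⟩
    (sign (ℤ.sign i) * sign (ℤ.sign j)) * ((ℤ.∣ i ∣ ×′ 1#) * (ℤ.∣ j ∣ ×′ 1#))
      ≡⟨ interchange _ _ _ _ ⟩
    (sign (ℤ.sign i) * (ℤ.∣ i ∣ ×′ 1#)) * (sign (ℤ.sign j) * (ℤ.∣ j ∣ ×′ 1#))
      ≡⟨ cong₂ _*_ (fromℤ-sign-abs i) (fromℤ-sign-abs j) ⟨
    fromℤ i * fromℤ j
      ∎
    where open ≡-Reasoning

  fromℤ-neg : ∀ i → fromℤ (ℤ.- i) ≡ - fromℤ i
  fromℤ-neg -[1+ n ]    = sym (-‿involutive _)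
  fromℤ-neg (ℤ.+ 0)     = sym -0#≈0#
  fromℤ-neg (ℤ.+ suc n) = refl

  homomorphism : ℤ.+-*-rawRing -Raw-AlmostCommutative⟶ fromCommutativeRing commutativeRing
  homomorphism = record
    { ⟦_⟧    = fromℤ
    ; +-homo = fromℤ-+
    ; *-homo = fromℤ-*
    ; -‿homo = fromℤ-neg
    ; 0-homo = refl
    ; 1-homo = refl
    }

  open import Algebra.Solver.Ring ℤ.+-*-rawRing (fromCommutativeRing commutativeRing) homomorphism
    (λ i j → Maybe.map (cong fromℤ) (dec⇒weaklyDec ℤ._≟_ i j)) public

-- Fields of characteristic other than two

module OddCharacteristicField
  {F : Set} {add mul : Op₂ F} {neg : Op₁ F} {zero one : F}
  (isCommutativeRing : IsCommutativeRing _≡_ add mul neg zero one)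
  (_≟_ : DecidableEquality F)
  (_⁻¹ : Op₁ F) (⁻¹-inverseʳ : ∀ {x} → x ≢ zero → mul x (x ⁻¹) ≡ one)
  (1+1≢0 : add one one ≢ zero) where

  open IntegerCoefficients isCommutativeRing public
  open CommutativeRing commutativeRing
    using (_+_; _*_; -_; _-_; 0#; 1#; ring; +-identityˡ; +-comm; -‿inverseʳ;
           *-comm; *-assoc; zeroˡ; zeroʳ; *-identityˡ; *-identityʳ)
  open import Algebra.Properties.Ring ring
    using (x∙y⁻¹≈ε⇒x≈y; x≈y⇒x∙y⁻¹≈ε; [y-z]x≈yx-zx; -‿injective; -0#≈0#; -‿involutive; -‿distribʳ-*)

  infix 10 _²
  _² : Op₁ F
  x ² = x * x

  κ : ℕ → ∀ {n} → Polynomial n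
  κ k = con (ℤ.+ k)

  2# 4# : F
  2# = fromℤ (ℤ.+ 2)
  4# = fromℤ (ℤ.+ 4)

  x-y≡0⇒x≡y : ∀ {x y} → x - y ≡ 0# → x ≡ y
  x-y≡0⇒x≡y = x∙y⁻¹≈ε⇒x≈y _ _

  -- A polynomial consequence l ≡ r of equations a ≡ b is proved by a certificate: the solver
  -- checks that l - r is the stated combination of the differences a - b.
  ≡-from-difference : ∀ {l r a b} c → l - r ≡ c * (a - b) → a ≡ b → l ≡ r
  ≡-from-difference c l-r≡ a≡b =
    x-y≡0⇒x≡y (trans l-r≡ (trans (cong (c *_) (x≈y⇒x∙y⁻¹≈ε a≡b)) (zeroʳ c)))

  ≡-from-differences : ∀ {l r a b a′ b′} c c′ → l - r ≡ c * (a - b) + c′ * (a′ - b′) →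
                       a ≡ b → a′ ≡ b′ → l ≡ r
  ≡-from-differences c c′ l-r≡ a≡b a′≡b′ = x-y≡0⇒x≡y (begin
    _                           ≡⟨ l-r≡ ⟩
    c * (_ - _) + c′ * (_ - _)  ≡⟨ cong₂ (λ u v → c * u + c′ * v) (x≈y⇒x∙y⁻¹≈ε a≡b)
                                                                  (x≈y⇒x∙y⁻¹≈ε a′≡b′) ⟩
    c * 0# + c′ * 0#            ≡⟨ cong₂ _+_ (zeroʳ c) (zeroʳ c′) ⟩
    0# + 0#                     ≡⟨ +-identityˡ 0# ⟩
    0#                          ∎)
    where open ≡-Reasoning

  zero-product : ∀ {x y} → x * y ≡ 0# → x ≡ 0# ⊎ y ≡ 0#
  zero-product {x} {y} xy≡0 with x ≟ 0#
  ... | yes x≡0 = inj₁ x≡0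
  ... | no  x≢0 = inj₂ (begin
    y               ≡⟨ *-identityˡ y ⟨
    1# * y          ≡⟨ cong (_* y) (trans (*-comm (x ⁻¹) x) (⁻¹-inverseʳ x≢0)) ⟨
    (x ⁻¹ * x) * y  ≡⟨ *-assoc (x ⁻¹) x y ⟩
    x ⁻¹ * (x * y)  ≡⟨ cong (x ⁻¹ *_) xy≡0 ⟩
    x ⁻¹ * 0#       ≡⟨ zeroʳ (x ⁻¹) ⟩
    0#              ∎)
    where open ≡-Reasoning

  *-≢0 : ∀ {x y} → x ≢ 0# → y ≢ 0# → x * y ≢ 0#
  *-≢0 x≢0 y≢0 xy≡0 = [ x≢0 , y≢0 ]′ (zero-product xy≡0)

  ²≡0⇒≡0 : ∀ {x} → x ² ≡ 0# → x ≡ 0#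
  ²≡0⇒≡0 x²≡0 = [ id , id ]′ (zero-product x²≡0)

  -x≢0 : ∀ {x} → x ≢ 0# → - x ≢ 0#
  -x≢0 x≢0 -x≡0 = x≢0 (-‿injective (trans -x≡0 (sym -0#≈0#)))

  *-cancelʳ : ∀ {x y z} → z ≢ 0# → x * z ≡ y * z → x ≡ y
  *-cancelʳ {x} {y} {z} z≢0 xz≡yz = [ x-y≡0⇒x≡y , ⊥-elim ∘ z≢0 ]′ (zero-product (begin
    (x - y) * z    ≡⟨ [y-z]x≈yx-zx z x y ⟩
    x * z - y * z  ≡⟨ x≈y⇒x∙y⁻¹≈ε xz≡yz ⟩
    0#             ∎))
    where open ≡-Reasoning

  *-cancelˡ : ∀ {x y z} → z ≢ 0# → z * x ≡ z * y → x ≡ y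
  *-cancelˡ {x} {y} {z} z≢0 zx≡zy = *-cancelʳ z≢0 (trans (*-comm x z) (trans zx≡zy (*-comm z y)))

  *-⁻¹-cancelʳ : ∀ {x} y → x ≢ 0# → y * x ⁻¹ * x ≡ y
  *-⁻¹-cancelʳ {x} y x≢0 = begin
    y * x ⁻¹ * x    ≡⟨ *-assoc y (x ⁻¹) x ⟩
    y * (x ⁻¹ * x)  ≡⟨ cong (y *_) (trans (*-comm (x ⁻¹) x) (⁻¹-inverseʳ x≢0)) ⟩
    y * 1#          ≡⟨ *-identityʳ y ⟩
    y               ∎
    where open ≡-Reasoning

  2≢0 : 2# ≢ 0#
  2≢0 = 1+1≢0

  4≢0 : 4# ≢ 0#
  4≢0 4≡0 = *-≢0 2≢0 2≢0 (trans (solve 0 (κ 2 :* κ 2 := κ 4) refl) 4≡0)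

  1≢0 : 1# ≢ 0#
  1≢0 1≡0 = 2≢0 (trans (cong (_+ 1#) 1≡0) (trans (+-identityˡ 1#) 1≡0))

  x≢-x : ∀ {x} → x ≢ 0# → x ≢ - x
  x≢-x {x} x≢0 x≡-x = *-≢0 2≢0 x≢0 (trans (solve 1 (λ x → κ 2 :* x := x :- (:- x)) refl x) (x≈y⇒x∙y⁻¹≈ε x≡-x))

  ⁻¹-≢0 : ∀ {x} → x ≢ 0# → x ⁻¹ ≢ 0#
  ⁻¹-≢0 {x} x≢0 x⁻¹≡0 = 1≢0 (trans (sym (⁻¹-inverseʳ x≢0)) (trans (cong (x *_) x⁻¹≡0) (zeroʳ x)))

  ⁻¹-involutive : ∀ {x} → x ≢ 0# → x ⁻¹ ⁻¹ ≡ x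
  ⁻¹-involutive {x} x≢0 = *-cancelˡ (⁻¹-≢0 x≢0)
    (trans (⁻¹-inverseʳ (⁻¹-≢0 x≢0)) (sym (trans (*-comm (x ⁻¹) x) (⁻¹-inverseʳ x≢0))))

  ⁻¹-neg : ∀ {x} → x ≢ 0# → (- x) ⁻¹ ≡ - x ⁻¹
  ⁻¹-neg {x} x≢0 = *-cancelˡ (-x≢0 x≢0) (trans (⁻¹-inverseʳ (-x≢0 x≢0))
    (sym (trans (solve 2 (λ x y → (:- x) :* (:- y) := x :* y) refl x (x ⁻¹)) (⁻¹-inverseʳ x≢0))))

  ²-≡-cases : ∀ {s t} → t ² ≡ s ² → t ≡ s ⊎ t ≡ - s
  ²-≡-cases {s} {t} t²≡s² = Sum.map x-y≡0⇒x≡y x-y≡0⇒x≡y (zero-product (trans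
    (solve 2 (λ s t → (t :- s) :* (t :- (:- s)) := t :* t :- s :* s) refl s t) (x≈y⇒x∙y⁻¹≈ε t²≡s²)))

  quartic-roots : ∀ {t} → (t ²) ² ≡ 1# → t ≡ 1# ⊎ t ≡ - 1# ⊎ t ² ≡ - 1#
  quartic-roots {t} t⁴≡1 =
    [ Sum.map₂ inj₁ ∘ ²-≡-cases ∘ x-y≡0⇒x≡y , inj₂ ∘ inj₂ ∘ x-y≡0⇒x≡y ]′ (zero-product (trans
    (solve 1 (λ t → (t :* t :- κ 1 :* κ 1) :* (t :* t :- (:- κ 1)) := (t :* t) :* (t :* t) :- κ 1) refl t)
    (x≈y⇒x∙y⁻¹≈ε t⁴≡1)))

  1²≡1 : 1# ² ≡ 1#
  1²≡1 = *-identityʳ 1#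

  -1²≡1 : (- 1#) ² ≡ 1#
  -1²≡1 = solve 0 ((:- κ 1) :* (:- κ 1) := κ 1) refl

  -- The fixed points of m₁ on the Markoff surface

  Triple : Set
  Triple = F × F × F

  OnSurface : Triple → Set
  OnSurface t@(x , y , z) = x ² + y ² + z ² ≡ x * y * z × t ≢ (0# , 0# , 0#)

  m₁ : Triple → Triple
  m₁ (x , y , z) = y * z - x , y , z

  Fixed : Triple → Set
  Fixed t = OnSurface t × m₁ t ≡ t

  swap₁₂ rotate : Triple → Triple
  swap₁₂ (x , y , z) = y , x , z
  rotate (x , y , z) = z , x , y

  OnSurface-swap₁₂ : ∀ {t} → OnSurface t → OnSurface (swap₁₂ t)
  OnSurface-swap₁₂ {x , y , z} (on , t≢0) =
    trans (solve 3 (λ x y z → y :* y :+ x :* x :+ z :* z := x :* x :+ y :* y :+ z :* z) refl x y z)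
          (trans on (solve 3 (λ x y z → x :* y :* z := y :* x :* z) refl x y z)) ,
    t≢0 ∘ cong swap₁₂

  OnSurface-rotate : ∀ {t} → OnSurface t → OnSurface (rotate t)
  OnSurface-rotate {x , y , z} (on , t≢0) =
    trans (solve 3 (λ x y z → z :* z :+ x :* x :+ y :* y := x :* x :+ y :* y :+ z :* z) refl x y z)
          (trans on (solve 3 (λ x y z → x :* y :* z := z :* x :* y) refl x y z)) ,
    t≢0 ∘ cong (rotate ∘ rotate)

  -- the (y, z)-projection of the fixed points of m₁, after eliminating x = yz/2
  Curve : F → F → Set
  Curve a b = 4# * a ² + 4# * b ² ≡ a ² * b ²

  Curve-sym : ∀ {a b} → Curve a b → Curve b a
  Curve-sym = subst₂ _≡_ (+-comm _ _) (*-comm _ _)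

  Curve-zero : ∀ {a b} → Curve a b → a ≡ 0# → b ≡ 0#
  Curve-zero {a} {b} curve a≡0 =
    ²≡0⇒≡0 ([ ⊥-elim ∘ 4≢0 , id ]′ (zero-product (≡-from-differences 1# (a * b ² - 4# * a)
      (solve 2 (λ a b → κ 4 :* (b :* b) :- κ 0
                        := κ 1 :* ((κ 4 :* (a :* a) :+ κ 4 :* (b :* b)) :- (a :* a) :* (b :* b))
                           :+ (a :* (b :* b) :- κ 4 :* a) :* (a :- κ 0)) refl a b)
      curve a≡0)))

  Admissible : F → Set
  Admissible t = t ≢ 0# × (t ²) ² ≢ 1#

  ²≡±1⇒¬Admissible : ∀ {c t} → c ² ≡ 1# → t ² ≡ c → ¬ Admissible t
  ²≡±1⇒¬Admissible c²≡1 t²≡c (_ , t⁴≢1) = t⁴≢1 (trans (cong _² t²≡c) c²≡1)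

  φ : Triple → F
  φ (x , y , z) = z * (y - 2#) * (2# * y) ⁻¹

  -- the inverse of φ, written with the single inversion w = 1 / (t (1 - t²))
  ψ : F → Triple
  ψ t = (1# + t ²) ² * w , 2# * (1# + t ²) * t * w , (1# + t ²) * (1# - t ²) * w
    where w = (t * (1# - t ²)) ⁻¹

  module FixedPoint {x y z} (fixed : Fixed (x , y , z)) where

    2x≡yz : 2# * x ≡ y * z
    2x≡yz = ≡-from-difference (- 1#)
      (solve 3 (λ x y z → κ 2 :* x :- y :* z := :- κ 1 :* ((y :* z :- x) :- x)) refl x y z)
      (cong proj₁ (proj₂ fixed))

    curve : Curve y z
    curve = ≡-from-differences 4# (x - (y * z - x))
      (solve 3 (λ x y z → (κ 4 :* (y :* y) :+ κ 4 :* (z :* z)) :- (y :* y) :* (z :* z)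
                          := κ 4 :* ((x :* x :+ y :* y :+ z :* z) :- x :* y :* z)
                             :+ (x :- (y :* z :- x)) :* ((y :* z :- x) :- x)) refl x y z)
      (proj₁ (proj₁ fixed)) (cong proj₁ (proj₂ fixed))

    y≢0 : y ≢ 0#
    y≢0 y≡0 = proj₂ (proj₁ fixed) (cong₂ _,_ x≡0 (cong₂ _,_ y≡0 z≡0))
      where
      z≡0 = Curve-zero curve y≡0
      x≡0 = [ ⊥-elim ∘ 2≢0 , id ]′ (zero-product (trans 2x≡yz (trans (cong (_* z) y≡0) (zeroˡ z))))

    z≢0 : z ≢ 0#
    z≢0 = y≢0 ∘ Curve-zero (Curve-sym curve)

    y²≢4 : y ² ≢ 4#
    y²≢4 y²≡4 = *-≢0 4≢0 4≢0 (≡-from-differences 1# (z ² - 4#)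
      (solve 2 (λ y z → κ 4 :* κ 4 :- κ 0
                        := κ 1 :* ((κ 4 :* (y :* y) :+ κ 4 :* (z :* z)) :- (y :* y) :* (z :* z))
                           :+ (z :* z :- κ 4) :* (y :* y :- κ 4)) refl y z)
      curve y²≡4)

    y-2≢0 : y - 2# ≢ 0#
    y-2≢0 y-2≡0 = y²≢4 (≡-from-difference (y + 2#)
      (solve 1 (λ y → y :* y :- κ 4 := (y :+ κ 2) :* (y :- κ 2 :- κ 0)) refl y) y-2≡0)

    y+2≢0 : y + 2# ≢ 0#
    y+2≢0 y+2≡0 = y²≢4 (≡-from-difference (y - 2#)
      (solve 1 (λ y → y :* y :- κ 4 := (y :- κ 2) :* (y :+ κ 2 :- κ 0)) refl y) y+2≡0)

    t : F
    t = φ (x , y , z)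

    t·2y≡z[y-2] : t * (2# * y) ≡ z * (y - 2#)
    t·2y≡z[y-2] = *-⁻¹-cancelʳ (z * (y - 2#)) (*-≢0 2≢0 y≢0)

    t≢0 : t ≢ 0#
    t≢0 t≡0 = *-≢0 z≢0 y-2≢0 (trans (sym t·2y≡z[y-2]) (trans (cong (_* (2# * y)) t≡0) (zeroˡ _)))

    t²[y+2]≡y-2 : t ² * (y + 2#) ≡ y - 2#
    t²[y+2]≡y-2 = *-cancelʳ (*-≢0 2y≢0 2y≢0)
      (≡-from-differences ((y + 2#) * (t * (2# * y) + z * (y - 2#))) (2# - y)
      (solve 3 (λ t y z → (t :* t) :* (y :+ κ 2) :* ((κ 2 :* y) :* (κ 2 :* y))
                            :- (y :- κ 2) :* ((κ 2 :* y) :* (κ 2 :* y))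
                          := (y :+ κ 2) :* (t :* (κ 2 :* y) :+ z :* (y :- κ 2)) :* (t :* (κ 2 :* y) :- z :* (y :- κ 2))
                             :+ (κ 2 :- y) :* ((κ 4 :* (y :* y) :+ κ 4 :* (z :* z)) :- (y :* y) :* (z :* z))) refl t y z)
      t·2y≡z[y-2] curve)
      where 2y≢0 = *-≢0 2≢0 y≢0

    t⁴≢1 : (t ²) ² ≢ 1#
    t⁴≢1 t⁴≡1 = *-≢0 (*-≢0 2≢0 4≢0) y≢0 (≡-from-differences (- (y + 2#) ²) (t ² * (y + 2#) + (y - 2#))
      (solve 2 (λ t y → κ 2 :* κ 4 :* y :- κ 0
                        := :- ((y :+ κ 2) :* (y :+ κ 2)) :* ((t :* t) :* (t :* t) :- κ 1)
                           :+ ((t :* t) :* (y :+ κ 2) :+ (y :- κ 2)) :* ((t :* t) :* (y :+ κ 2) :- (y :- κ 2))) refl t y)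
      t⁴≡1 t²[y+2]≡y-2)

    admissible : Admissible t
    admissible = t≢0 , t⁴≢1

    y[1-t²]≡2[1+t²] : y * (1# - t ²) ≡ 2# * (1# + t ²)
    y[1-t²]≡2[1+t²] = ≡-from-difference (- 1#)
      (solve 2 (λ t y → y :* (κ 1 :- t :* t) :- κ 2 :* (κ 1 :+ t :* t)
                        := :- κ 1 :* ((t :* t) :* (y :+ κ 2) :- (y :- κ 2))) refl t y)
      t²[y+2]≡y-2

    zt≡1+t² : z * t ≡ 1# + t ²
    zt≡1+t² = *-cancelʳ (*-≢0 (*-≢0 2≢0 y≢0) y+2≢0) (≡-from-differences 1# (- (2# * y))
      (solve 3 (λ t y z → z :* t :* ((κ 2 :* y) :* (y :+ κ 2)) :- (κ 1 :+ t :* t) :* ((κ 2 :* y) :* (y :+ κ 2))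
                          := κ 1 :* (z :* (t :* (κ 2 :* y)) :* (y :+ κ 2) :- κ 4 :* (y :* y))
                             :+ (:- (κ 2 :* y)) :* ((t :* t) :* (y :+ κ 2) :- (y :- κ 2))) refl t y z)
      zt·2y[y+2]≡4y² t²[y+2]≡y-2)
      where
      zt·2y[y+2]≡4y² : z * (t * (2# * y)) * (y + 2#) ≡ 4# * y ²
      zt·2y[y+2]≡4y² = ≡-from-differences ((y + 2#) * z) (- 1#)
        (solve 3 (λ t y z → z :* (t :* (κ 2 :* y)) :* (y :+ κ 2) :- κ 4 :* (y :* y)
                            := ((y :+ κ 2) :* z) :* (t :* (κ 2 :* y) :- z :* (y :- κ 2))
                               :+ (:- κ 1) :* ((κ 4 :* (y :* y) :+ κ 4 :* (z :* z)) :- (y :* y) :* (z :* z))) refl t y z)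
        t·2y≡z[y-2] curve

  module _ {t} (adm : Admissible t) where

    1+t²≢0 : 1# + t ² ≢ 0#
    1+t²≢0 e = proj₂ adm (≡-from-difference (t ² - 1#)
      (solve 1 (λ t → (t :* t) :* (t :* t) :- κ 1 := (t :* t :- κ 1) :* (κ 1 :+ t :* t :- κ 0)) refl t) e)

    1-t²≢0 : 1# - t ² ≢ 0#
    1-t²≢0 e = proj₂ adm (≡-from-difference (- (1# + t ²))
      (solve 1 (λ t → (t :* t) :* (t :* t) :- κ 1 := (:- (κ 1 :+ t :* t)) :* (κ 1 :- t :* t :- κ 0)) refl t) e)

    private
      w : F
      w = (t * (1# - t ²)) ⁻¹

      t[1-t²]w≡1 : t * (1# - t ²) * w ≡ 1#
      t[1-t²]w≡1 = ⁻¹-inverseʳ (*-≢0 (proj₁ adm) 1-t²≢0)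

    ψ-fixed : Fixed (ψ t)
    ψ-fixed = (on-surface , nonzero) , cong (_, proj₂ (ψ t)) moved
      where
      on-surface = ≡-from-difference (- (2# * (1# + t ²) ² * (1# + t ²) ² * w * w))
        (solve 2 (λ t w → let e = κ 1 :+ t :* t; d = κ 1 :- t :* t in
                          (e :* e :* w) :* (e :* e :* w) :+ (κ 2 :* e :* t :* w) :* (κ 2 :* e :* t :* w)
                            :+ (e :* d :* w) :* (e :* d :* w)
                          :- (e :* e :* w) :* (κ 2 :* e :* t :* w) :* (e :* d :* w)
                          := (:- (κ 2 :* (e :* e) :* (e :* e) :* w :* w)) :* (t :* d :* w :- κ 1)) refl t w)
        t[1-t²]w≡1
      moved = ≡-from-difference (2# * (1# + t ²) ² * w)
        (solve 2 (λ t w → let e = κ 1 :+ t :* t; d = κ 1 :- t :* t in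
                          (κ 2 :* e :* t :* w) :* (e :* d :* w) :- e :* e :* w :- e :* e :* w
                          := (κ 2 :* (e :* e) :* w) :* (t :* d :* w :- κ 1)) refl t w)
        t[1-t²]w≡1
      zt≡1+t² : (1# + t ²) * (1# - t ²) * w * t ≡ 1# + t ²
      zt≡1+t² = ≡-from-difference (1# + t ²)
        (solve 2 (λ t w → let e = κ 1 :+ t :* t; d = κ 1 :- t :* t in
                          e :* d :* w :* t :- e := e :* (t :* d :* w :- κ 1)) refl t w)
        t[1-t²]w≡1
      nonzero : ψ t ≢ (0# , 0# , 0#)
      nonzero ψt≡0 = 1+t²≢0 (trans (sym zt≡1+t²) (trans (cong (λ v → proj₂ (proj₂ v) * t) ψt≡0) (zeroˡ t)))

    φ∘ψ : φ (ψ t) ≡ t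
    φ∘ψ = *-cancelʳ (*-≢0 2≢0 B.y≢0) (trans B.t·2y≡z[y-2] (≡-from-difference (2# * (1# + t ²) ² * w)
      (solve 2 (λ t w → let e = κ 1 :+ t :* t; d = κ 1 :- t :* t in
                        (e :* d :* w) :* (κ 2 :* e :* t :* w :- κ 2) :- t :* (κ 2 :* (κ 2 :* e :* t :* w))
                        := (κ 2 :* (e :* e) :* w) :* (t :* d :* w :- κ 1)) refl t w)
      t[1-t²]w≡1))
      where module B = FixedPoint ψ-fixed

  -- A fixed point is recovered from t = φ v through y (1 - t²) = 2 (1 + t²), z t = 1 + t² and 2x = yz.
  φ-injective : ∀ {u v} → Fixed u → Fixed v → φ u ≡ φ v → u ≡ v
  φ-injective {x , y , z} {x′ , y′ , z′} fixed fixed′ φu≡φv = cong₂ _,_ x≡x′ (cong₂ _,_ y≡y′ z≡z′)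
    where
    module U = FixedPoint fixed
    module V = FixedPoint fixed′
    t = U.t
    V-at-t : y′ * (1# - t ²) ≡ 2# * (1# + t ²) × z′ * t ≡ 1# + t ²
    V-at-t rewrite φu≡φv = V.y[1-t²]≡2[1+t²] , V.zt≡1+t²
    y≡y′ = *-cancelʳ (1-t²≢0 U.admissible) (trans U.y[1-t²]≡2[1+t²] (sym (proj₁ V-at-t)))
    z≡z′ = *-cancelʳ U.t≢0 (trans U.zt≡1+t² (sym (proj₂ V-at-t)))
    x≡x′ = *-cancelˡ 2≢0 (trans U.2x≡yz (trans (cong₂ _*_ y≡y′ z≡z′) (sym V.2x≡yz)))

  ψ∘φ : ∀ {v} → Fixed v → ψ (φ v) ≡ v
  ψ∘φ fixed = φ-injective (ψ-fixed adm) fixed (φ∘ψ adm)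
    where adm = FixedPoint.admissible fixed

  Admissible-neg : ∀ {t} → Admissible t → Admissible (- t)
  Admissible-neg {t} (t≢0 , t⁴≢1) =
    -x≢0 t≢0 ,
    t⁴≢1 ∘ trans (solve 1 (λ t → (t :* t) :* (t :* t) := ((:- t) :* (:- t)) :* ((:- t) :* (:- t))) refl t)

  Admissible-⁻¹ : ∀ {t} → Admissible t → Admissible (t ⁻¹)
  Admissible-⁻¹ {t} (t≢0 , t⁴≢1) = ⁻¹-≢0 t≢0 , λ t⁻⁴≡1 → t⁴≢1 (begin
    (t ²) ²                   ≡⟨ *-identityʳ _ ⟨
    (t ²) ² * 1#              ≡⟨ cong ((t ²) ² *_) t⁻⁴≡1 ⟨
    (t ²) ² * ((t ⁻¹ ²) ²)    ≡⟨ solve 2 (λ t s → (t :* t) :* (t :* t) :* ((s :* s) :* (s :* s))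
                                                := ((t :* s) :* (t :* s)) :* ((t :* s) :* (t :* s))) refl t (t ⁻¹) ⟩
    ((t * t ⁻¹) ²) ²          ≡⟨ cong (λ u → (u ²) ²) (⁻¹-inverseʳ t≢0) ⟩
    (1# ²) ²                  ≡⟨ trans (cong _² 1²≡1) 1²≡1 ⟩
    1#                        ∎)
    where open ≡-Reasoning

  orbit : F → List F
  orbit t = t ∷ - t ∷ t ⁻¹ ∷ - t ⁻¹ ∷ []

  module _ {t} (adm : Admissible t) where

    private
      t≢0 = proj₁ adm

    orbit-unique : Unique (orbit t)
    orbit-unique = (t≢-t ∷ t≢t⁻¹ ∷ t≢-t⁻¹ ∷ []) ∷ (-t≢t⁻¹ ∷ -t≢-t⁻¹ ∷ []) ∷ (t⁻¹≢-t⁻¹ ∷ []) ∷ [] ∷ []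
      where
      t≢-t = x≢-x t≢0
      t≢t⁻¹ : t ≢ t ⁻¹
      t≢t⁻¹ e = ²≡±1⇒¬Admissible 1²≡1 (trans (cong (t *_) e) (⁻¹-inverseʳ t≢0)) adm
      t≢-t⁻¹ : t ≢ - t ⁻¹
      t≢-t⁻¹ e = ²≡±1⇒¬Admissible -1²≡1
        (trans (cong (t *_) e) (trans (sym (-‿distribʳ-* t (t ⁻¹))) (cong -_ (⁻¹-inverseʳ t≢0)))) adm
      -t≢t⁻¹ : - t ≢ t ⁻¹
      -t≢t⁻¹ e = t≢-t⁻¹ (trans (sym (-‿involutive t)) (cong -_ e))
      -t≢-t⁻¹ = t≢t⁻¹ ∘ -‿injective
      t⁻¹≢-t⁻¹ = x≢-x (⁻¹-≢0 t≢0)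

    neg-∈-orbit : ∀ {a} → a ∈ orbit t → - a ∈ orbit t
    neg-∈-orbit (here refl)                         = there (here refl)
    neg-∈-orbit (there (here refl))                 = here (-‿involutive t)
    neg-∈-orbit (there (there (here refl)))         = there (there (there (here refl)))
    neg-∈-orbit (there (there (there (here refl)))) = there (there (here (-‿involutive (t ⁻¹))))

    ⁻¹-∈-orbit : ∀ {a} → a ∈ orbit t → a ⁻¹ ∈ orbit t
    ⁻¹-∈-orbit (here refl)                         = there (there (here refl))
    ⁻¹-∈-orbit (there (here refl))                 = there (there (there (here (⁻¹-neg t≢0))))
    ⁻¹-∈-orbit (there (there (here refl)))         = here (⁻¹-involutive t≢0)
    ⁻¹-∈-orbit (there (there (there (here refl)))) =
      there (here (trans (⁻¹-neg (⁻¹-≢0 t≢0)) (cong -_ (⁻¹-involutive t≢0))))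

    orbit-admissible : ∀ {a} → a ∈ orbit t → Admissible a
    orbit-admissible (here refl)                         = adm
    orbit-admissible (there (here refl))                 = Admissible-neg adm
    orbit-admissible (there (there (here refl)))         = Admissible-⁻¹ adm
    orbit-admissible (there (there (there (here refl)))) = Admissible-neg (Admissible-⁻¹ adm)

    orbit-trans : ∀ {a b} → a ∈ orbit t → b ∈ orbit a → b ∈ orbit t
    orbit-trans a∈ (here refl)                         = a∈
    orbit-trans a∈ (there (here refl))                 = neg-∈-orbit a∈
    orbit-trans a∈ (there (there (here refl)))         = ⁻¹-∈-orbit a∈
    orbit-trans a∈ (there (there (there (here refl)))) = neg-∈-orbit (⁻¹-∈-orbit a∈)

  orbit-sym : ∀ {a b} → Admissible b → a ∈ orbit b → b ∈ orbit a
  orbit-sym adm (here refl) = here refl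
  orbit-sym {b = b} adm a∈@(there (here refl)) =
    subst (_∈ orbit (- b)) (-‿involutive b) (neg-∈-orbit (orbit-admissible adm a∈) (here refl))
  orbit-sym {b = b} adm a∈@(there (there (here refl))) =
    subst (_∈ orbit (b ⁻¹)) (⁻¹-involutive (proj₁ adm)) (⁻¹-∈-orbit (orbit-admissible adm a∈) (here refl))
  orbit-sym {b = b} adm a∈@(there (there (there (here refl)))) =
    subst (_∈ orbit (- b ⁻¹)) (trans (cong _⁻¹ (-‿involutive (b ⁻¹))) (⁻¹-involutive (proj₁ adm)))
      (⁻¹-∈-orbit adm′ (neg-∈-orbit adm′ (here refl)))
    where adm′ = orbit-admissible adm a∈

  ¬Admissible⇒0∨quartic-root : ∀ {t} → ¬ Admissible t → t ≡ 0# ⊎ (t ²) ² ≡ 1#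
  ¬Admissible⇒0∨quartic-root {t} ¬adm with t ≟ 0# | ((t ²) ²) ≟ 1#
  ... | yes t≡0 | _        = inj₁ t≡0
  ... | no _    | yes t⁴≡1 = inj₂ t⁴≡1
  ... | no t≢0  | no t⁴≢1  = ⊥-elim (¬adm (t≢0 , t⁴≢1))

  [0,±1] : List F
  [0,±1] = 0# ∷ 1# ∷ - 1# ∷ []

  [0,±1,±_] : F → List F
  [0,±1,± i ] = 0# ∷ 1# ∷ - 1# ∷ i ∷ - i ∷ []

  [0,±1]-unique : Unique [0,±1]
  [0,±1]-unique = ((1≢0 ∘ sym) ∷ (-x≢0 1≢0 ∘ sym) ∷ []) ∷ (x≢-x 1≢0 ∷ []) ∷ [] ∷ []

  ¬Admissible⇔∈[0,±1] : (∀ {i} → i ² ≢ - 1#) → ∀ {t} → (¬ Admissible t) ⇔ (t ∈ [0,±1])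
  ¬Admissible⇔∈[0,±1] no-i = mk⇔ to from
    where
    to : ∀ {t} → ¬ Admissible t → t ∈ [0,±1]
    to ¬adm with ¬Admissible⇒0∨quartic-root ¬adm
    ... | inj₁ t≡0 = here t≡0
    ... | inj₂ t⁴≡1 with quartic-roots t⁴≡1
    ...   | inj₁ t≡1          = there (here t≡1)
    ...   | inj₂ (inj₁ t≡-1)  = there (there (here t≡-1))
    ...   | inj₂ (inj₂ t²≡-1) = ⊥-elim (no-i t²≡-1)
    from : ∀ {t} → t ∈ [0,±1] → ¬ Admissible t
    from (here refl)                 = λ adm → proj₁ adm refl
    from (there (here refl))         = ²≡±1⇒¬Admissible 1²≡1 1²≡1
    from (there (there (here refl))) = ²≡±1⇒¬Admissible 1²≡1 -1²≡1

  module _ {i} (i²≡-1 : i ² ≡ - 1#) where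

    private
      -i²≡-1 : (- i) ² ≡ - 1#
      -i²≡-1 = trans (solve 1 (λ i → (:- i) :* (:- i) := i :* i) refl i) i²≡-1

      i≢0 : i ≢ 0#
      i≢0 i≡0 = -x≢0 1≢0 (trans (sym i²≡-1) (trans (cong _² i≡0) (zeroˡ 0#)))

      ²-separates : ∀ {a b} → a ² ≡ 1# → b ² ≡ - 1# → a ≢ b
      ²-separates a²≡1 b²≡-1 a≡b = x≢-x 1≢0 (trans (sym a²≡1) (trans (cong _² a≡b) b²≡-1))

    [0,±1,±i]-unique : Unique [0,±1,± i ]
    [0,±1,±i]-unique =
      ((1≢0 ∘ sym) ∷ (-x≢0 1≢0 ∘ sym) ∷ (i≢0 ∘ sym) ∷ (-x≢0 i≢0 ∘ sym) ∷ []) ∷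
      (x≢-x 1≢0 ∷ ²-separates 1²≡1 i²≡-1 ∷ ²-separates 1²≡1 -i²≡-1 ∷ []) ∷
      (²-separates -1²≡1 i²≡-1 ∷ ²-separates -1²≡1 -i²≡-1 ∷ []) ∷
      (x≢-x i≢0 ∷ []) ∷ [] ∷ []

    ¬Admissible⇔∈[0,±1,±i] : ∀ {t} → (¬ Admissible t) ⇔ (t ∈ [0,±1,± i ])
    ¬Admissible⇔∈[0,±1,±i] = mk⇔ to from
      where
      to : ∀ {t} → ¬ Admissible t → t ∈ [0,±1,± i ]
      to ¬adm with ¬Admissible⇒0∨quartic-root ¬adm
      ... | inj₁ t≡0 = here t≡0
      ... | inj₂ t⁴≡1 with quartic-roots t⁴≡1
      ...   | inj₁ t≡1          = there (here t≡1)
      ...   | inj₂ (inj₁ t≡-1)  = there (there (here t≡-1))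
      ...   | inj₂ (inj₂ t²≡-1) with ²-≡-cases (trans t²≡-1 (sym i²≡-1))
      ...     | inj₁ t≡i  = there (there (there (here t≡i)))
      ...     | inj₂ t≡-i = there (there (there (there (here t≡-i))))
      from : ∀ {t} → t ∈ [0,±1,± i ] → ¬ Admissible t
      from (here refl)                                 = λ adm → proj₁ adm refl
      from (there (here refl))                         = ²≡±1⇒¬Admissible 1²≡1 1²≡1
      from (there (there (here refl)))                 = ²≡±1⇒¬Admissible 1²≡1 -1²≡1
      from (there (there (there (here refl))))         = ²≡±1⇒¬Admissible -1²≡1 i²≡-1
      from (there (there (there (there (here refl))))) = ²≡±1⇒¬Admissible -1²≡1 -i²≡-1

module PrimeField (p : ℕ) .{{_ : NonZero p}} where

  open Field p

  private
    [_] : ℕ → F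
    [ m ] = m mod p

    mod-cong : ∀ {m n} → m % p ≡ n % p → [ m ] ≡ [ n ]
    mod-cong {m} {n} eq = Fin.fromℕ<-cong (m % p) (n % p) eq (m%n<n m p) (m%n<n n p)

    [toℕ] : ∀ a → [ toℕ a ] ≡ a
    [toℕ] a = Fin.toℕ-injective (trans (Fin.toℕ-fromℕ< (m%n<n (toℕ a) p)) (m<n⇒m%n≡m (Fin.toℕ<n a)))

    []-homo : ∀ (_∙_ : ℕ → ℕ → ℕ) → (∀ m n → (m ∙ n) % p ≡ ((m % p) ∙ (n % p)) % p) →
              ∀ m n → [ toℕ [ m ] ∙ toℕ [ n ] ] ≡ [ m ∙ n ]
    []-homo _∙_ %-distrib m n = mod-cong (trans
      (cong₂ (λ a b → (a ∙ b) % p) (Fin.toℕ-fromℕ< (m%n<n m p)) (Fin.toℕ-fromℕ< (m%n<n n p)))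
      (sym (%-distrib m n)))

    [+] : ∀ m n → [ m ] +F [ n ] ≡ [ m ℕ.+ n ]
    [+] = []-homo ℕ._+_ (λ m n → %-distribˡ-+ m n p)

    [*] : ∀ m n → [ m ] *F [ n ] ≡ [ m ℕ.* n ]
    [*] = []-homo ℕ._*_ (λ m n → %-distribˡ-* m n p)

    [+]ˡ : ∀ m b → [ m ] +F b ≡ [ m ℕ.+ toℕ b ]
    [+]ˡ m b = trans (cong ([ m ] +F_) (sym ([toℕ] b))) ([+] m (toℕ b))

    [+]ʳ : ∀ a n → a +F [ n ] ≡ [ toℕ a ℕ.+ n ]
    [+]ʳ a n = trans (cong (_+F [ n ]) (sym ([toℕ] a))) ([+] (toℕ a) n)

    [*]ˡ : ∀ m b → [ m ] *F b ≡ [ m ℕ.* toℕ b ]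
    [*]ˡ m b = trans (cong ([ m ] *F_) (sym ([toℕ] b))) ([*] m (toℕ b))

    [*]ʳ : ∀ a n → a *F [ n ] ≡ [ toℕ a ℕ.* n ]
    [*]ʳ a n = trans (cong (_*F [ n ]) (sym ([toℕ] a))) ([*] (toℕ a) n)

    [xp]≡0 : ∀ x → [ x ℕ.* p ] ≡ 0F
    [xp]≡0 x = mod-cong (trans (m*n%n≡0 x p) (sym (m*n%n≡0 0 p)))

  1F : F
  1F = [ 1 ]

  isCommutativeRing : IsCommutativeRing _≡_ _+F_ _*F_ (λ a → -F a) 0F 1F
  isCommutativeRing = record
    { isRing = record
      { +-isAbelianGroup = record
        { isGroup = record
          { isMonoid = record
            { isSemigroup = record
              { isMagma = record { isEquivalence = isEquivalence ; ∙-cong = cong₂ _+F_ }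
              ; assoc   = +-assoc
              }
            ; identity = comm∧idˡ⇒id +-comm +-identityˡ
            }
          ; inverse = comm∧invˡ⇒inv +-comm -‿inverseˡ
          ; ⁻¹-cong = cong (λ a → -F a)
          }
        ; comm = +-comm
        }
      ; *-cong     = cong₂ _*F_
      ; *-assoc    = *-assoc
      ; *-identity = comm∧idˡ⇒id *-comm *-identityˡ
      ; distrib    = comm∧distrˡ⇒distr (cong₂ _+F_) *-comm distribˡ
      }
    ; *-comm = *-comm
    }
    where
    +-assoc : ∀ a b c → (a +F b) +F c ≡ a +F (b +F c)
    +-assoc a b c = trans ([+]ˡ _ c) (trans (cong [_] (ℕ.+-assoc (toℕ a) (toℕ b) (toℕ c))) (sym ([+]ʳ a _)))
    *-assoc : ∀ a b c → (a *F b) *F c ≡ a *F (b *F c)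
    *-assoc a b c = trans ([*]ˡ _ c) (trans (cong [_] (ℕ.*-assoc (toℕ a) (toℕ b) (toℕ c))) (sym ([*]ʳ a _)))
    +-comm : ∀ a b → a +F b ≡ b +F a
    +-comm a b = cong [_] (ℕ.+-comm (toℕ a) (toℕ b))
    *-comm : ∀ a b → a *F b ≡ b *F a
    *-comm a b = cong [_] (ℕ.*-comm (toℕ a) (toℕ b))
    +-identityˡ : ∀ a → 0F +F a ≡ a
    +-identityˡ a = trans ([+]ˡ 0 a) ([toℕ] a)
    *-identityˡ : ∀ a → 1F *F a ≡ a
    *-identityˡ a = trans ([*]ˡ 1 a) (trans (cong [_] (ℕ.*-identityˡ (toℕ a))) ([toℕ] a))
    -‿inverseˡ : ∀ a → (-F a) +F a ≡ 0F
    -‿inverseˡ a = trans ([+]ˡ _ a) (mod-cong (begin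
      (p ∸ toℕ a ℕ.+ toℕ a) % p  ≡⟨ cong (_% p) (ℕ.m∸n+n≡m (ℕ.<⇒≤ (Fin.toℕ<n a))) ⟩
      p % p                      ≡⟨ n%n≡0 p ⟩
      0                          ≡⟨ m*n%n≡0 0 p ⟨
      0 % p                      ∎))
      where open ≡-Reasoning
    distribˡ : ∀ a b c → a *F (b +F c) ≡ (a *F b) +F (a *F c)
    distribˡ a b c = trans ([*]ʳ a _) (trans (cong [_] (ℕ.*-distribˡ-+ (toℕ a) (toℕ b) (toℕ c))) (sym ([+] _ _)))

  private
    commutativeRing : CommutativeRing 0ℓ 0ℓ
    commutativeRing = record { isCommutativeRing = isCommutativeRing }

    open CommutativeRing commutativeRing using (ring; +-identityʳ; *-comm)
    open import Algebra.Properties.Ring ring using (+-inverseʳ-unique; -‿distribʳ-*; -‿involutive)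

  inverse-exists : Prime p → ∀ {a} → a ≢ 0F → ∃ λ b → a *F b ≡ 1F
  inverse-exists p-prime {a} a≢0
    with coprime-Bézout (prime⇒coprime p-prime {{ℕ.≢-nonZero toℕa≢0}} (Fin.toℕ<n a))
    where toℕa≢0 = λ a≡0 → a≢0 (trans (sym ([toℕ] a)) (cong [_] a≡0))
  ... | Bézout.+- x y 1+ya≡xp = -F [ y ] , (begin
    a *F (-F [ y ])  ≡⟨ -‿distribʳ-* a [ y ] ⟨
    -F (a *F [ y ])  ≡⟨ cong (λ b → -F b) (+-inverseʳ-unique 1F (a *F [ y ]) 1+ay≡0) ⟩
    -F (-F 1F)       ≡⟨ -‿involutive 1F ⟩
    1F               ∎)
    where
    open ≡-Reasoning
    1+ay≡0 : 1F +F (a *F [ y ]) ≡ 0F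
    1+ay≡0 = begin
      1F +F (a *F [ y ])     ≡⟨ cong (1F +F_) (trans (*-comm a [ y ]) ([*]ˡ y a)) ⟩
      1F +F [ y ℕ.* toℕ a ]  ≡⟨ [+] 1 _ ⟩
      [ 1 ℕ.+ y ℕ.* toℕ a ]  ≡⟨ cong [_] 1+ya≡xp ⟩
      [ x ℕ.* p ]            ≡⟨ [xp]≡0 x ⟩
      0F                     ∎
  ... | Bézout.-+ x y 1+xp≡ya = [ y ] , (begin
    a *F [ y ]          ≡⟨ trans (*-comm a [ y ]) ([*]ˡ y a) ⟩
    [ y ℕ.* toℕ a ]     ≡⟨ cong [_] 1+xp≡ya ⟨
    [ 1 ℕ.+ x ℕ.* p ]   ≡⟨ [+] 1 _ ⟨
    1F +F [ x ℕ.* p ]   ≡⟨ cong (1F +F_) ([xp]≡0 x) ⟩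
    1F +F 0F            ≡⟨ +-identityʳ 1F ⟩
    1F                  ∎)
    where open ≡-Reasoning

  -- junk value 0F when a has no inverse, i.e. for a ≡ 0F
  infix 10 _⁻¹
  _⁻¹ : F → F
  a ⁻¹ with Fin.any? (λ b → a *F b Fin.≟ 1F)
  ... | yes (b , _) = b
  ... | no _        = 0F

  ⁻¹-inverseʳ : Prime p → ∀ {a} → a ≢ 0F → a *F a ⁻¹ ≡ 1F
  ⁻¹-inverseʳ p-prime {a} a≢0 with Fin.any? (λ b → a *F b Fin.≟ 1F)
  ... | yes (_ , ab≡1) = ab≡1
  ... | no ∄b          = contradiction (inverse-exists p-prime a≢0) ∄b

  1+1≢0 : 2 ℕ.< p → 1F +F 1F ≢ 0F
  1+1≢0 2<p 1+1≡0 = ℕ.1+n≢0 (begin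
    2               ≡⟨ m<n⇒m%n≡m 2<p ⟨
    2 % p           ≡⟨ Fin.toℕ-fromℕ< (m%n<n 2 p) ⟨
    toℕ [ 2 ]       ≡⟨ cong toℕ ([+] 1 1) ⟨
    toℕ (1F +F 1F)  ≡⟨ cong toℕ 1+1≡0 ⟩
    toℕ 0F          ≡⟨ Fin.toℕ-fromℕ< (m%n<n 0 p) ⟩
    0 % p           ≡⟨ m*n%n≡0 0 p ⟩
    0               ∎)
    where open ≡-Reasoning

odd-prime>2 : ∀ {p} → Prime p → p % 2 ≡ 1 → 2 ℕ.< p
odd-prime>2 {p} p-prime p-odd = ℕ.≤∧≢⇒< (ℕ.nonTrivial⇒n>1 p {{prime⇒nonTrivial p-prime}})
  (λ 2≡p → ℕ.0≢1+n (trans (cong (_% 2) 2≡p) p-odd))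

module FixedPointCount (p : ℕ) .{{_ : NonZero p}} (p-prime : Prime p) (p-odd : p % 2 ≡ 1) where

  open Field p using (-F_; 0F; allTriples; FixedPt; FixedPt?; numFixed)
  open PrimeField p
  open OddCharacteristicField isCommutativeRing Fin._≟_
         _⁻¹ (⁻¹-inverseʳ p-prime) (1+1≢0 (odd-prime>2 p-prime p-odd))

  Admissible? : Decidable Admissible
  Admissible? t = ¬? (t Fin.≟ 0F) ×-dec ¬? (((t ²) ²) Fin.≟ 1F)

  #admissible #non-admissible : ℕ
  #admissible     = length (filter Admissible? (allFin p))
  #non-admissible = length (filter (∁? Admissible?) (allFin p))

  private
    allTriples-unique : Unique allTriples
    allTriples-unique =
      Unique.cartesianProduct⁺ (Unique.allFin⁺ p) (Unique.cartesianProduct⁺ (Unique.allFin⁺ p) (Unique.allFin⁺ p))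

    ∈-allTriples : ∀ t → t ∈ allTriples
    ∈-allTriples (x , y , z) = ∈-cartesianProduct⁺ (∈-allFin x) (∈-cartesianProduct⁺ (∈-allFin y) (∈-allFin z))

    numFixed≡#admissible-by-conjugation : ∀ i (σ τ : Triple → Triple) →
      (∀ {t} → FixedPt i t → Fixed (σ t)) → (∀ {u} → Fixed u → FixedPt i (τ u)) →
      (∀ t → τ (σ t) ≡ t) → (∀ u → σ (τ u) ≡ u) → numFixed i ≡ #admissible
    numFixed≡#admissible-by-conjugation i σ τ to from τσ στ =
      length-filter-bijection (FixedPt? i) Admissible? (φ ∘ σ) (τ ∘ ψ)
        (FixedPoint.admissible ∘ to) (from ∘ ψ-fixed)
        (λ fixed → trans (cong τ (ψ∘φ (to fixed))) (τσ _))
        (λ adm → trans (cong φ (στ _)) (φ∘ψ adm))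
        allTriples-unique (Unique.allFin⁺ p) ∈-allTriples ∈-allFin

  numFixed≡#admissible : ∀ i → numFixed i ≡ #admissible
  numFixed≡#admissible Fin.zero =
    numFixed≡#admissible-by-conjugation Fin.zero id id id id (λ _ → refl) (λ _ → refl)
  numFixed≡#admissible i@(Fin.suc Fin.zero) =
    numFixed≡#admissible-by-conjugation i swap₁₂ swap₁₂ to from (λ _ → refl) (λ _ → refl)
    where
    to : ∀ {t} → FixedPt i t → Fixed (swap₁₂ t)
    to {x , y , z} (on , moved) = OnSurface-swap₁₂ on , cong (_, x , z) (cong (proj₁ ∘ proj₂) moved)
    from : ∀ {u} → Fixed u → FixedPt i (swap₁₂ u)
    from {a , b , c} (on , moved) = OnSurface-swap₁₂ on , cong (λ m → b , m , c) (cong proj₁ moved)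
  numFixed≡#admissible i@(Fin.suc (Fin.suc Fin.zero)) =
    numFixed≡#admissible-by-conjugation i rotate (rotate ∘ rotate) to from (λ _ → refl) (λ _ → refl)
    where
    to : ∀ {t} → FixedPt i t → Fixed (rotate t)
    to {x , y , z} (on , moved) = OnSurface-rotate on , cong (_, x , y) (cong (proj₂ ∘ proj₂) moved)
    from : ∀ {u} → Fixed u → FixedPt i (rotate (rotate u))
    from {a , b , c} (on , moved) = OnSurface-rotate (OnSurface-rotate on) , cong (λ m → b , c , m) (cong proj₁ moved)

  #admissible+#non-admissible≡p : #admissible ℕ.+ #non-admissible ≡ p
  #admissible+#non-admissible≡p = trans (length-filter-∁ Admissible? (allFin p)) (length-tabulate id)

  private
    #non-admissible≡length : ∀ {L} → Unique L → (∀ {t} → (¬ Admissible t) ⇔ (t ∈ L)) →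
                             #non-admissible ≡ length L
    #non-admissible≡length L! ¬adm⇔∈L =
      unique∧set⇒length-≡ (Unique.filter⁺ (∁? Admissible?) (Unique.allFin⁺ p)) L!
        (¬adm⇔∈L ⇔-∘ mk⇔ (proj₂ ∘ ∈-filter⁻ (∁? Admissible?) {xs = allFin p})
                         (∈-filter⁺ (∁? Admissible?) (∈-allFin _)))

  #non-admissible≡3∨5 : #non-admissible ≡ 3 ⊎ #non-admissible ≡ 5
  #non-admissible≡3∨5 with Fin.any? (λ i → (i ²) Fin.≟ (-F 1F))
  ... | yes (i , i²≡-1) =
    inj₂ (#non-admissible≡length ([0,±1,±i]-unique {i} i²≡-1) (¬Admissible⇔∈[0,±1,±i] {i} i²≡-1))
  ... | no ∄i =
    inj₁ (#non-admissible≡length [0,±1]-unique (¬Admissible⇔∈[0,±1] (λ {i} i²≡-1 → ∄i (i , i²≡-1))))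

  4∣#admissible : 4 ∣ #admissible
  4∣#admissible =
    orbits-divide (Unique.filter⁺ Admissible? (Unique.allFin⁺ p)) (all-filter Admissible? (allFin p)) closed
    where
    open Orbits Fin._≟_ 4 orbit orbit-unique (λ _ → refl) (λ _ → here refl) orbit-sym (λ adm → orbit-trans adm)
    closed : Closed (filter Admissible? (allFin p))
    closed a∈ b∈ =
      ∈-filter⁺ Admissible? (∈-allFin _) (orbit-admissible (proj₂ (∈-filter⁻ Admissible? {xs = allFin p} a∈)) b∈)

  private
    module _ {c} (#non-admissible≡c : #non-admissible ≡ c) where

      #admissible+c≡p : #admissible ℕ.+ c ≡ p
      #admissible+c≡p = subst (λ n → #admissible ℕ.+ n ≡ p) #non-admissible≡c #admissible+#non-admissible≡p

      p%4≡c%4 : p % 4 ≡ c % 4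
      p%4≡c%4 = trans (cong (_% 4) (sym #admissible+c≡p)) (%-remove-+ˡ c 4∣#admissible)

      #admissible≡p∸c : #admissible ≡ p ∸ c
      #admissible≡p∸c = trans (sym (ℕ.m+n∸n≡m #admissible c)) (cong (_∸ c) #admissible+c≡p)

  #admissible-by-residue : (p % 4 ≡ 1 → #admissible ≡ p ∸ 5) × (p % 4 ≡ 3 → #admissible ≡ p ∸ 3)
  #admissible-by-residue with #non-admissible≡3∨5
  ... | inj₁ ≡3 = (λ p%4≡1 → contradiction (trans (sym (p%4≡c%4 ≡3)) p%4≡1) λ ()) ,
                  (λ _ → #admissible≡p∸c ≡3)
  ... | inj₂ ≡5 = (λ _ → #admissible≡p∸c ≡5) ,
                  (λ p%4≡3 → contradiction (trans (sym (p%4≡c%4 ≡5)) p%4≡3) λ ())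

lemma2p3 : (p : ℕ) .{{_ : NonZero p}} → Prime p → p % 2 ≡ 1 → (i : Fin 3) →
    (p % 4 ≡ 1 → Field.numFixed p i ≡ p ∸ 5) × (p % 4 ≡ 3 → Field.numFixed p i ≡ p ∸ 3)
lemma2p3 p p-prime p-odd i =
  Product.map (trans (numFixed≡#admissible i) ∘_) (trans (numFixed≡#admissible i) ∘_) #admissible-by-residue
  where open FixedPointCount p p-prime p-odd
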